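{- Let $G=(V,E,\mathbf{u})$, $s$, $t$, $F>0$ be as in the context, with $m=|E|$, and let $0\le\alpha<1$. Let $f$ be a $\chi_\alpha$-flow that is feasible in $G$ and let $y\in\mathbb{R}^V$ be such that the pair $(f,y)$ is well-coupled. If \[\chi^T y>\frac{2m}{1-\alpha},\] then the demand $\chi$ cannot be routed in $G$ by a feasible flow, i.e., $F>F^*$.
   Context: $G=(V,E,\mathbf{u})$ is a directed multigraph with $m=|E|$ arcs; each arc $e=(u,v)$ (tail $u$, head $v$) has two nonnegative integer capacities $u_e^-,u_e^+$. A flow is a vector $f\in\mathbb{R}^E$ (a negative value means flow against the orientation). For $\sigma\in\mathbb{R}^V$, $f$ is a $\sigma$-flow if $\sum_{e\in E^+(v)}f_e-\sum_{e\in E^-(v)}f_e=\sigma_v$ for every vertex $v$, where $E^+(v)$ (resp. $E^-(v)$) are the arcs entering (resp. leaving) $v$; it is feasible in $G$ if $-u_e^-\le f_e\le u_e^+$ for every arc $e$. Fix a source $s$, a sink $t$ and a target value $F>0$; $\chi_{s,t}\in\mathbb{R}^V$ has $-1$ at $s$, $+1$ at $t$ and $0$ elsewhere; $\chi_\alpha:=\alpha F\chi_{s,t}$ and $\chi:=\chi_1$. $F^*$ is the maximum $F'$ such that a feasible $F'\chi_{s,t}$-flow exists. Residual capacities of a feasible flow $f$: $\hat u_e^+(f)=u_e^+-f_e$, $\hat u_e^-(f)=u_e^-+f_e$, $\hat u_e(f)=\min\{\hat u_e^+(f),\hat u_e^-(f)\}$ (assumed positive wherever they appear in a denominator). For $y\in\mathbb{R}^V$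 and an arc $e=(u,v)$ let $\Delta_e(y)=y_v-y_u$ and $\Phi_e(f)=\frac{1}{\hat u_e^+(f)}-\frac{1}{\hat u_e^-(f)}$. For $\gamma\in\mathbb{R}^E$, $(f,y)$ is $\gamma$-coupled if $|\Delta_e(y)-\Phi_e(f)|\le \gamma_e/\hat u_e(f)$ for all arcs $e$; it is well-coupled if it is $\gamma$-coupled for some $\gamma$ with $\|\gamma\|_2\le 1/100$. -}

module Defs where

open import Level using (0ℓ)
open import Data.Nat as ℕ using (ℕ; zero; suc)
open import Data.Fin using (Fin; zero; suc; _≟_)
open import Data.Sum using (_⊎_; [_,_]′)
open import Data.Product using (Σ; _×_; _,_)
open import Relation.Nullary using (¬_; Dec; yes; no)
open import Relation.Binary.PropositionalEquality using (_≡_; _≢_)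
open import Algebra.Structures using (IsCommutativeRing)

-- The real numbers, axiomatised as a complete ordered field.
-- (Any two complete ordered fields are isomorphic, so quantifying over
-- every such record is the same as speaking about ℝ.)
-- Inverse is total (0⁻¹ is unspecified); it is only used for nonzero
-- arguments.

record RealField : Set₁ where
  infixl 7 _*_ _/_
  infixl 6 _-_
  infix 8 -_
  infixl 6 _+_
  infix  4 _≤_ _<_
  field
    Carrier : Set
    _+_ _*_ : Carrier → Carrier → Carrier
    -_      : Carrier → Carrier
    0# 1#   : Carrier
    _⁻¹     : Carrier → Carrier
    _≤_     : Carrier → Carrier → Set
    isCommutativeRing : IsCommutativeRing _≡_ _+_ _*_ -_ 0# 1#
    0≢1        : 0# ≢ 1#
    ⁻¹-inverse : ∀ x → x ≢ 0# → x * (x ⁻¹) ≡ 1#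
    ≤-refl     : ∀ x → x ≤ x
    ≤-trans    : ∀ {x y z} → x ≤ y → y ≤ z → x ≤ z
    ≤-antisym  : ∀ {x y} → x ≤ y → y ≤ x → x ≡ y
    ≤-total    : ∀ x y → x ≤ y ⊎ y ≤ x
    +-mono-≤   : ∀ {x y} z → x ≤ y → x + z ≤ y + z
    *-nonneg   : ∀ {x y} → 0# ≤ x → 0# ≤ y → 0# ≤ x * y
    sup : (P : Carrier → Set) → Σ Carrier P → Σ Carrier (λ b → ∀ x → P x → x ≤ b) →
          Σ Carrier (λ s → (∀ x → P x → x ≤ s) ×
                           (∀ b → (∀ x → P x → x ≤ b) → s ≤ b))

  _<_ : Carrier → Carrier → Set
  x < y = x ≤ y × x ≢ y

  _-_ : Carrier → Carrier → Carrier
  x - y = x + (- y)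

  _/_ : Carrier → Carrier → Carrier
  x / y = x * (y ⁻¹)

  fromℕ : ℕ → Carrier
  fromℕ zero    = 0#
  fromℕ (suc n) = 1# + fromℕ n

  min : Carrier → Carrier → Carrier
  min x y = [ (λ _ → x) , (λ _ → y) ]′ (≤-total x y)

  ∣_∣ : Carrier → Carrier
  ∣ x ∣ = [ (λ _ → - x) , (λ _ → x) ]′ (≤-total x (- x))

  sumFin : (k : ℕ) → (Fin k → Carrier) → Carrier
  sumFin zero    g = 0#
  sumFin (suc k) g = g zero + sumFin k (λ i → g (suc i))

  [_≟_]𝟙 : {n : ℕ} → Fin n → Fin n → Carrier
  [ a ≟ b ]𝟙 with a Data.Fin.≟ b
  ... | yes _ = 1#
  ... | no  _ = 0#

record Network (n m : ℕ) : Set where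
  field
    tail head : Fin m → Fin n
    u⁻ u⁺     : Fin m → ℕ

module Flows (R : RealField) {n m : ℕ} (G : Network n m) where
  open RealField R
  open Network G

  Vec𝕍 = Fin n → Carrier
  Vec𝔼 = Fin m → Carrier

  IsFlow : Vec𝕍 → Vec𝔼 → Set
  IsFlow σ f = ∀ v → sumFin m (λ e → [ head e ≟ v ]𝟙 * f e)
                     - sumFin m (λ e → [ tail e ≟ v ]𝟙 * f e) ≡ σ v

  Feasible : Vec𝔼 → Set
  Feasible f = ∀ e → (- fromℕ (u⁻ e) ≤ f e) × (f e ≤ fromℕ (u⁺ e))

  χst : Fin n → Fin n → Vec𝕍
  χst s t v = [ v ≟ t ]𝟙 - [ v ≟ s ]𝟙

  χ[_] : Fin n → Fin n → Carrier → Carrier → Vec𝕍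
  χ[ s ] t F α v = α * F * χst s t v

  dot𝕍 : Vec𝕍 → Vec𝕍 → Carrier
  dot𝕍 a b = sumFin n (λ v → a v * b v)

  û⁺ û⁻ û : Vec𝔼 → Fin m → Carrier
  û⁺ f e = fromℕ (u⁺ e) - f e
  û⁻ f e = fromℕ (u⁻ e) + f e
  û  f e = min (û⁺ f e) (û⁻ f e)

  Δ : Vec𝕍 → Fin m → Carrier
  Δ y e = y (head e) - y (tail e)

  Φ : Vec𝔼 → Fin m → Carrier
  Φ f e = (1# / û⁺ f e) - (1# / û⁻ f e)

  -- (f,y) is γ-coupled (residual capacities assumed positive, as they
  -- appear in denominators)
  Coupled : Vec𝔼 → Vec𝔼 → Vec𝕍 → Set
  Coupled γ f y = ∀ e → (0# < û⁺ f e) × (0# < û⁻ f e) ×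
                        (∣ Δ y e - Φ f e ∣ ≤ γ e / û f e)

  -- ‖γ‖₂ ≤ c  (for c ≥ 0), written without square roots as Σ γ_e² ≤ c²
  ‖_‖₂≤_ : Vec𝔼 → Carrier → Set
  ‖ γ ‖₂≤ c = sumFin m (λ e → γ e * γ e) ≤ c * c

  WellCoupled : Vec𝔼 → Vec𝕍 → Set
  WellCoupled f y = Σ Vec𝔼 (λ γ → Coupled γ f y × ‖ γ ‖₂≤ (1# / fromℕ 100))

-- Comparing the two flows through the potentials y: for a χ-flow g,
-- χᵀy − χ_αᵀy = Σ_e (g_e − f_e) Δ_e(y).  Feasibility of g puts g_e − f_e in
-- [−û⁻_e(f), û⁺_e(f)], and coupling puts Δ_e(y) within 1/û_e(f) of
-- 1/û⁺_e(f) − 1/û⁻_e(f); together every term is at most 2, so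
-- (1 − α) χᵀy ≤ 2m, contradicting the hypothesis.

module Submission where

open import Defs
open import Level using (0ℓ)
open import Data.Nat as ℕ using (ℕ; zero; suc)
import Data.Nat.Properties as ℕ
open import Data.Fin using (Fin; zero; suc)
import Data.Fin as Fin
open import Data.Integer as ℤ using (ℤ; -[1+_]; _⊖_; _◃_)
import Data.Integer.Properties as ℤ
open import Data.Sign as Sign using (Sign)
open import Data.Maybe using (Maybe; just; nothing)
open import Data.Sum using (inj₁; inj₂; [_,_]′)
open import Data.Product using (Σ; _×_; _,_; proj₁; proj₂)
open import Relation.Nullary using (¬_; yes; no; contradiction)
open import Relation.Binary.PropositionalEquality
open import Relation.Binary.Bundles using (Poset)
open import Algebra.Bundles using (CommutativeRing)
open import Algebra.Solver.Ring.AlmostCommutativeRing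
  using (fromCommutativeRing; _-Raw-AlmostCommutative⟶_)
import Algebra.Solver.Ring as RingSolver
import Algebra.Properties.Ring as RingProperties
import Algebra.Properties.AbelianGroup as AbelianGroupProperties
import Algebra.Properties.Semiring.Sum as SemiringSum
import Relation.Binary.Reasoning.PartialOrder as PosetReasoning

module RealFieldProperties (R : RealField) where
  open RealField R hiding (+-mono-≤)

  commutativeRing : CommutativeRing 0ℓ 0ℓ
  commutativeRing = record { isCommutativeRing = isCommutativeRing }

  open CommutativeRing commutativeRing public
    using (+-assoc; +-comm; +-identityˡ; +-identityʳ; *-assoc; *-comm;
           *-identityˡ; *-identityʳ; -‿inverseʳ; zeroˡ; zeroʳ; distribˡ; distribʳ)
  open CommutativeRing commutativeRing using (ring; semiring; +-abelianGroup)
  open RingProperties ring using (-0#≈0#; -‿involutive; -‿distribˡ-*; -‿distribʳ-*)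
  open AbelianGroupProperties +-abelianGroup using (⁻¹-∙-comm; xyx⁻¹≈y)
  open SemiringSum semiring public
    using (sum; sum-cong-≗; ∑-distrib-+; ∑-comm; *-distribˡ-sum; *-distribʳ-sum)

  -- The ring solver takes its coefficients from ℤ, embedded by fromℤ.

  fromℕ-+ : ∀ a b → fromℕ (a ℕ.+ b) ≡ fromℕ a + fromℕ b
  fromℕ-+ zero    b = sym (+-identityˡ _)
  fromℕ-+ (suc a) b = trans (cong (1# +_) (fromℕ-+ a b)) (sym (+-assoc _ _ _))

  fromℕ-* : ∀ a b → fromℕ (a ℕ.* b) ≡ fromℕ a * fromℕ b
  fromℕ-* zero    b = sym (zeroˡ _)
  fromℕ-* (suc a) b = begin
    fromℕ (b ℕ.+ a ℕ.* b)            ≡⟨ fromℕ-+ b (a ℕ.* b) ⟩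
    fromℕ b + fromℕ (a ℕ.* b)        ≡⟨ cong₂ _+_ (sym (*-identityˡ _)) (fromℕ-* a b) ⟩
    1# * fromℕ b + fromℕ a * fromℕ b ≡⟨ sym (distribʳ _ _ _) ⟩
    (1# + fromℕ a) * fromℕ b         ∎
    where open ≡-Reasoning

  fromℤ : ℤ → Carrier
  fromℤ (ℤ.+ n)    = fromℕ n
  fromℤ -[1+ n ] = - fromℕ (suc n)

  fromℤ-⊖ : ∀ a b → fromℤ (a ⊖ b) ≡ fromℕ a - fromℕ b
  fromℤ-⊖ a       zero    = sym (trans (cong (fromℕ a +_) -0#≈0#) (+-identityʳ _))
  fromℤ-⊖ zero    (suc b) = sym (+-identityˡ _)
  fromℤ-⊖ (suc a) (suc b) = begin
    fromℤ (suc a ⊖ suc b)          ≡⟨ cong fromℤ (ℤ.[1+m]⊖[1+n]≡m⊖n a b) ⟩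
    fromℤ (a ⊖ b)                  ≡⟨ fromℤ-⊖ a b ⟩
    A - B                          ≡⟨ sym (xyx⁻¹≈y 1# (A - B)) ⟩
    1# + (A + - B) + - 1#          ≡⟨ cong (_+ - 1#) (sym (+-assoc 1# A (- B))) ⟩
    (1# + A) + - B + - 1#          ≡⟨ +-assoc (1# + A) (- B) (- 1#) ⟩
    (1# + A) + (- B + - 1#)        ≡⟨ cong ((1# + A) +_) (+-comm (- B) (- 1#)) ⟩
    (1# + A) + (- 1# + - B)        ≡⟨ cong ((1# + A) +_) (⁻¹-∙-comm 1# B) ⟩
    (1# + A) - (1# + B)            ∎
    where
    open ≡-Reasoning
    A B : Carrier
    A = fromℕ a
    B = fromℕ b

  fromℤ-+ : ∀ i j → fromℤ (i ℤ.+ j) ≡ fromℤ i + fromℤ j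
  fromℤ-+ (ℤ.+ a)    (ℤ.+ b)    = fromℕ-+ a b
  fromℤ-+ (ℤ.+ a)    -[1+ b ] = fromℤ-⊖ a (suc b)
  fromℤ-+ -[1+ a ] (ℤ.+ b)    = trans (fromℤ-⊖ b (suc a)) (+-comm _ _)
  fromℤ-+ -[1+ a ] -[1+ b ] = begin
    - fromℕ (suc (suc (a ℕ.+ b)))       ≡⟨ cong (λ k → - fromℕ (suc k)) (sym (ℕ.+-suc a b)) ⟩
    - fromℕ (suc a ℕ.+ suc b)           ≡⟨ cong -_ (fromℕ-+ (suc a) (suc b)) ⟩
    - (fromℕ (suc a) + fromℕ (suc b))   ≡⟨ sym (⁻¹-∙-comm _ _) ⟩
    - fromℕ (suc a) + - fromℕ (suc b)   ∎
    where open ≡-Reasoning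

  fromℤ-neg : ∀ i → fromℤ (ℤ.- i) ≡ - fromℤ i
  fromℤ-neg (ℤ.+ zero)    = sym -0#≈0#
  fromℤ-neg (ℤ.+ suc n)   = refl
  fromℤ-neg -[1+ n ]    = sym (-‿involutive _)

  applySign : Sign → Carrier → Carrier
  applySign Sign.+ x = x
  applySign Sign.- x = - x

  applySign-* : ∀ s t x y → applySign (s Sign.* t) (x * y) ≡ applySign s x * applySign t y
  applySign-* Sign.+ Sign.+ x y = refl
  applySign-* Sign.+ Sign.- x y = -‿distribʳ-* x y
  applySign-* Sign.- Sign.+ x y = -‿distribˡ-* x y
  applySign-* Sign.- Sign.- x y = begin
    x * y         ≡⟨ sym (-‿involutive _) ⟩
    - - (x * y)   ≡⟨ cong -_ (-‿distribʳ-* x y) ⟩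
    - (x * - y)   ≡⟨ -‿distribˡ-* x (- y) ⟩
    - x * - y     ∎
    where open ≡-Reasoning

  fromℤ-◃ : ∀ s n → fromℤ (s ◃ n) ≡ applySign s (fromℕ n)
  fromℤ-◃ Sign.+ zero    = refl
  fromℤ-◃ Sign.- zero    = sym -0#≈0#
  fromℤ-◃ Sign.+ (suc n) = refl
  fromℤ-◃ Sign.- (suc n) = refl

  fromℤ-sign-abs : ∀ i → fromℤ i ≡ applySign (ℤ.sign i) (fromℕ ℤ.∣ i ∣)
  fromℤ-sign-abs (ℤ.+ n)    = refl
  fromℤ-sign-abs -[1+ n ] = refl

  fromℤ-* : ∀ i j → fromℤ (i ℤ.* j) ≡ fromℤ i * fromℤ j
  fromℤ-* i j = begin
    fromℤ (s ◃ ∣i∣ ℕ.* ∣j∣)                             ≡⟨ fromℤ-◃ s (∣i∣ ℕ.* ∣j∣) ⟩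
    applySign s (fromℕ (∣i∣ ℕ.* ∣j∣))                    ≡⟨ cong (applySign s) (fromℕ-* ∣i∣ ∣j∣) ⟩
    applySign s (fromℕ ∣i∣ * fromℕ ∣j∣)                  ≡⟨ applySign-* (ℤ.sign i) (ℤ.sign j) _ _ ⟩
    applySign (ℤ.sign i) (fromℕ ∣i∣) * applySign (ℤ.sign j) (fromℕ ∣j∣)
                                                         ≡⟨ sym (cong₂ _*_ (fromℤ-sign-abs i) (fromℤ-sign-abs j)) ⟩
    fromℤ i * fromℤ j                                    ∎
    where
    open ≡-Reasoning
    s = ℤ.sign i Sign.* ℤ.sign j
    ∣i∣ = ℤ.∣ i ∣
    ∣j∣ = ℤ.∣ j ∣

  fromℤ-morphism : ℤ.+-*-rawRing -Raw-AlmostCommutative⟶ fromCommutativeRing commutativeRing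
  fromℤ-morphism = record
    { ⟦_⟧ = fromℤ ; +-homo = fromℤ-+ ; *-homo = fromℤ-* ; -‿homo = fromℤ-neg
    ; 0-homo = refl ; 1-homo = +-identityʳ 1# }

  fromℤ-≟ : (i j : ℤ) → Maybe (fromℤ i ≡ fromℤ j)
  fromℤ-≟ i j with i ℤ.≟ j
  ... | yes i≡j = just (cong fromℤ i≡j)
  ... | no  _   = nothing

  open RingSolver ℤ.+-*-rawRing (fromCommutativeRing commutativeRing) fromℤ-morphism fromℤ-≟
    public using (solve; _:+_; _:-_; _:*_; :-_; _:=_; con)

  ≤-poset : Poset 0ℓ 0ℓ 0ℓ
  ≤-poset = record
    { isPartialOrder = record
      { isPreorder = record
        { isEquivalence = isEquivalence ; reflexive = λ { refl → ≤-refl _ } ; trans = ≤-trans }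
      ; antisym = ≤-antisym } }

  open Poset ≤-poset public using (≤-respˡ-≈; ≤-respʳ-≈)
  module ≤-Reasoning = PosetReasoning ≤-poset

  +-monoˡ-≤ : ∀ z {x y} → x ≤ y → x + z ≤ y + z
  +-monoˡ-≤ z x≤y = RealField.+-mono-≤ R z x≤y

  +-monoʳ-≤ : ∀ z {x y} → x ≤ y → z + x ≤ z + y
  +-monoʳ-≤ z {x} {y} x≤y = subst₂ _≤_ (+-comm x z) (+-comm y z) (+-monoˡ-≤ z x≤y)

  +-mono-≤ : ∀ {x y u v} → x ≤ y → u ≤ v → x + u ≤ y + v
  +-mono-≤ {y = y} {u} x≤y u≤v = ≤-trans (+-monoˡ-≤ u x≤y) (+-monoʳ-≤ y u≤v)

  x≤y⇒0≤y-x : ∀ {x y} → x ≤ y → 0# ≤ y - x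
  x≤y⇒0≤y-x {x} x≤y = ≤-respˡ-≈ (-‿inverseʳ x) (+-monoˡ-≤ (- x) x≤y)

  0≤y-x⇒x≤y : ∀ {x y} → 0# ≤ y - x → x ≤ y
  0≤y-x⇒x≤y {x} {y} 0≤y-x =
    subst₂ _≤_ (+-identityˡ x) (solve 2 (λ x y → y :- x :+ x := y) refl x y) (+-monoˡ-≤ x 0≤y-x)

  neg-antimono-≤ : ∀ {x y} → x ≤ y → - y ≤ - x
  neg-antimono-≤ {x} {y} x≤y = 0≤y-x⇒x≤y
    (≤-respʳ-≈ (solve 2 (λ x y → y :- x := :- x :- :- y) refl x y) (x≤y⇒0≤y-x x≤y))

  x≤0⇒0≤-x : ∀ {x} → x ≤ 0# → 0# ≤ - x
  x≤0⇒0≤-x x≤0 = ≤-respˡ-≈ -0#≈0# (neg-antimono-≤ x≤0)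

  *-monoˡ-≤-nonNeg : ∀ {z x y} → 0# ≤ z → x ≤ y → x * z ≤ y * z
  *-monoˡ-≤-nonNeg {z} {x} {y} 0≤z x≤y = 0≤y-x⇒x≤y
    (≤-respʳ-≈ (solve 3 (λ z x y → (y :- x) :* z := y :* z :- x :* z) refl z x y)
           (*-nonneg (x≤y⇒0≤y-x x≤y) 0≤z))

  *-monoʳ-≤-nonNeg : ∀ {z x y} → 0# ≤ z → x ≤ y → z * x ≤ z * y
  *-monoʳ-≤-nonNeg {z} {x} {y} 0≤z x≤y = subst₂ _≤_ (*-comm x z) (*-comm y z) (*-monoˡ-≤-nonNeg 0≤z x≤y)

  0≤x*x : ∀ x → 0# ≤ x * x
  0≤x*x x with ≤-total 0# x
  ... | inj₁ 0≤x = *-nonneg 0≤x 0≤x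
  ... | inj₂ x≤0 = ≤-respʳ-≈ (solve 1 (λ x → :- x :* :- x := x :* x) refl x)
                         (*-nonneg (x≤0⇒0≤-x x≤0) (x≤0⇒0≤-x x≤0))

  0≤1 : 0# ≤ 1#
  0≤1 = ≤-respʳ-≈ (*-identityˡ 1#) (0≤x*x 1#)

  1≰0 : ¬ (1# ≤ 0#)
  1≰0 1≤0 = 0≢1 (≤-antisym 0≤1 1≤0)

  x≤x+y : ∀ x {y} → 0# ≤ y → x ≤ x + y
  x≤x+y x 0≤y = ≤-respˡ-≈ (+-identityʳ x) (+-monoʳ-≤ x 0≤y)

  0≤x⇒0≤x⁻¹ : ∀ {x} → 0# ≤ x → x ≢ 0# → 0# ≤ x ⁻¹
  0≤x⇒0≤x⁻¹ {x} 0≤x x≢0 with ≤-total 0# (x ⁻¹)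
  ... | inj₁ 0≤x⁻¹ = 0≤x⁻¹
  ... | inj₂ x⁻¹≤0 = contradiction 1≤0 1≰0
    where
    1≤0 : 1# ≤ 0#
    1≤0 = subst₂ _≤_ (⁻¹-inverse x x≢0) (zeroʳ x) (*-monoʳ-≤-nonNeg 0≤x x⁻¹≤0)

  1≤x⇒0≤1/x≤1 : ∀ {x} → 1# ≤ x → 0# ≤ 1# / x × 1# / x ≤ 1#
  1≤x⇒0≤1/x≤1 {x} 1≤x = *-nonneg 0≤1 0≤x⁻¹ , (begin
    1# * x ⁻¹   ≤⟨ *-monoˡ-≤-nonNeg 0≤x⁻¹ 1≤x ⟩
    x * x ⁻¹    ≡⟨ ⁻¹-inverse x x≢0 ⟩
    1#          ∎)
    where
    open ≤-Reasoning
    x≢0 : x ≢ 0#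
    x≢0 refl = 1≰0 1≤x
    0≤x⁻¹ : 0# ≤ x ⁻¹
    0≤x⁻¹ = 0≤x⇒0≤x⁻¹ (≤-trans 0≤1 1≤x) x≢0

  x*x≤1⇒x≤1 : ∀ {x} → x * x ≤ 1# → x ≤ 1#
  x*x≤1⇒x≤1 {x} x*x≤1 with ≤-total x 1#
  ... | inj₁ x≤1 = x≤1
  ... | inj₂ 1≤x = ≤-trans (≤-respˡ-≈ (*-identityʳ x) (*-monoʳ-≤-nonNeg (≤-trans 0≤1 1≤x) 1≤x)) x*x≤1

  0≤x≤1⇒x*x≤1 : ∀ {x} → 0# ≤ x → x ≤ 1# → x * x ≤ 1#
  0≤x≤1⇒x*x≤1 {x} 0≤x x≤1 = ≤-trans (≤-respʳ-≈ (*-identityʳ x) (*-monoʳ-≤-nonNeg 0≤x x≤1)) x≤1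

  0≤fromℕ : ∀ n → 0# ≤ fromℕ n
  0≤fromℕ zero    = ≤-refl 0#
  0≤fromℕ (suc n) = ≤-respˡ-≈ (+-identityʳ 0#) (+-mono-≤ 0≤1 (0≤fromℕ n))

  1≤fromℕ[1+n] : ∀ n → 1# ≤ fromℕ (suc n)
  1≤fromℕ[1+n] n = x≤x+y 1# (0≤fromℕ n)

  ∣x∣≤y⇒-y≤x≤y : ∀ {x y} → ∣ x ∣ ≤ y → - y ≤ x × x ≤ y
  ∣x∣≤y⇒-y≤x≤y {x} {y} ∣x∣≤y with ≤-total x (- x)
  ... | inj₁ x≤-x = ≤-respʳ-≈ (-‿involutive x) (neg-antimono-≤ ∣x∣≤y) , ≤-trans x≤-x ∣x∣≤y
  ... | inj₂ -x≤x = ≤-trans (neg-antimono-≤ ∣x∣≤y) (≤-respʳ-≈ (-‿involutive x) (neg-antimono-≤ -x≤x))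
                  , ∣x∣≤y

  min-elim : ∀ (P : Carrier → Set) {x y} → P x → P y → P (min x y)
  min-elim P {x} {y} Px Py with ≤-total x y
  ... | inj₁ _ = Px
  ... | inj₂ _ = Py

  x<y⇒0<y-x : ∀ {x y} → x < y → 0# < y - x
  x<y⇒0<y-x {x} {y} (x≤y , x≢y) = x≤y⇒0≤y-x x≤y , λ 0≡y-x → x≢y (begin
    x               ≡⟨ sym (+-identityˡ x) ⟩
    0# + x          ≡⟨ cong (_+ x) 0≡y-x ⟩
    y - x + x       ≡⟨ solve 2 (λ x y → y :- x :+ x := y) refl x y ⟩
    y               ∎)
    where open ≡-Reasoning

  0<x⇒0≤x⁻¹ : ∀ {x} → 0# < x → 0# ≤ x ⁻¹
  0<x⇒0≤x⁻¹ (0≤x , 0≢x) = 0≤x⇒0≤x⁻¹ 0≤x (λ x≡0 → 0≢x (sym x≡0))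

  z*x≤y⇒x≤y/z : ∀ {x y z} → 0# < z → z * x ≤ y → x ≤ y / z
  z*x≤y⇒x≤y/z {x} {y} {z} 0<z@(_ , 0≢z) z*x≤y = begin
    x                ≡⟨ sym (*-identityʳ x) ⟩
    x * 1#           ≡⟨ cong (x *_) (sym (⁻¹-inverse z z≢0)) ⟩
    x * (z * z ⁻¹)   ≡⟨ solve 3 (λ x z z⁻¹ → x :* (z :* z⁻¹) := z :* x :* z⁻¹) refl x z (z ⁻¹) ⟩
    z * x * z ⁻¹     ≤⟨ *-monoˡ-≤-nonNeg (0<x⇒0≤x⁻¹ 0<z) z*x≤y ⟩
    y / z            ∎
    where
    open ≤-Reasoning
    z≢0 : z ≢ 0#
    z≢0 z≡0 = 0≢z (sym z≡0)

  -- With A = 1/a and B = 1/b, the coupling error ε is at most 1/min(a,b) ≤ A + B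
  -- in absolute value, so dδ = d(A − B) + dε is at most 2dA ≤ 2 when d ≥ 0 and
  -- at most −2dB ≤ 2 when d ≤ 0.
  coupled-step≤2 : ∀ {a b d δ γ} → 0# < a → 0# < b → - b ≤ d → d ≤ a → γ ≤ 1# →
                   ∣ δ - (1# / a - 1# / b) ∣ ≤ γ / min a b → d * δ ≤ fromℕ 2
  coupled-step≤2 {a} {b} {d} {δ} 0<a 0<b -b≤d d≤a γ≤1 ∣ε∣≤γ/min = [ nonNeg , nonPos ]′ (≤-total 0# d)
    where
    open ≤-Reasoning
    A B ε : Carrier
    A = a ⁻¹
    B = b ⁻¹
    ε = δ - (1# / a - 1# / b)

    inverse-bound : ∀ {x z} → 0# < x → z ≤ x → z * x ⁻¹ ≤ 1#
    inverse-bound {x} 0<x z≤x =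
      ≤-respʳ-≈ (⁻¹-inverse x (λ x≡0 → proj₂ 0<x (sym x≡0))) (*-monoˡ-≤-nonNeg (0<x⇒0≤x⁻¹ 0<x) z≤x)

    split : d * δ ≡ d * (A - B) + d * ε
    split = begin-equality
      d * δ                                ≡⟨ solve 4 (λ d δ A B → d :* δ := d :* (A :- B) :+ d :* (δ :- (A :- B)))
                                                      refl d δ A B ⟩
      d * (A - B) + d * (δ - (A - B))      ≡⟨ cong (λ w → d * (A - B) + d * (δ - w))
                                                   (sym (cong₂ _-_ (*-identityˡ A) (*-identityˡ B))) ⟩
      d * (A - B) + d * ε                  ∎

    1/min≤A+B : min a b ⁻¹ ≤ A + B
    1/min≤A+B = min-elim (λ w → w ⁻¹ ≤ A + B)
      (x≤x+y A (0<x⇒0≤x⁻¹ 0<b)) (≤-respˡ-≈ (+-identityˡ B) (+-monoˡ-≤ B (0<x⇒0≤x⁻¹ 0<a)))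

    ∣ε∣≤A+B : ∣ ε ∣ ≤ A + B
    ∣ε∣≤A+B = ≤-trans ∣ε∣≤γ/min (≤-trans
      (≤-respʳ-≈ (*-identityˡ _) (*-monoˡ-≤-nonNeg (0<x⇒0≤x⁻¹ (min-elim (0# <_) 0<a 0<b)) γ≤1))
      1/min≤A+B)

    ε≤A+B : ε ≤ A + B
    ε≤A+B = proj₂ (∣x∣≤y⇒-y≤x≤y ∣ε∣≤A+B)

    -ε≤A+B : - ε ≤ A + B
    -ε≤A+B = ≤-respʳ-≈ (-‿involutive _) (neg-antimono-≤ (proj₁ (∣x∣≤y⇒-y≤x≤y ∣ε∣≤A+B)))

    nonNeg : 0# ≤ d → d * δ ≤ fromℕ 2
    nonNeg 0≤d = begin
      d * δ                        ≡⟨ split ⟩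
      d * (A - B) + d * ε          ≤⟨ +-monoʳ-≤ (d * (A - B)) (*-monoʳ-≤-nonNeg 0≤d ε≤A+B) ⟩
      d * (A - B) + d * (A + B)    ≡⟨ solve 3 (λ d A B → d :* (A :- B) :+ d :* (A :+ B)
                                                     := con (ℤ.+ 2) :* (d :* A)) refl d A B ⟩
      fromℕ 2 * (d * A)            ≤⟨ *-monoʳ-≤-nonNeg (0≤fromℕ 2) (inverse-bound 0<a d≤a) ⟩
      fromℕ 2 * 1#                 ≡⟨ *-identityʳ _ ⟩
      fromℕ 2                      ∎

    nonPos : d ≤ 0# → d * δ ≤ fromℕ 2
    nonPos d≤0 = begin
      d * δ                        ≡⟨ split ⟩
      d * (A - B) + d * ε          ≡⟨ cong (d * (A - B) +_) (solve 2 (λ d ε → d :* ε := :- d :* :- ε) refl d ε) ⟩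
      d * (A - B) + - d * - ε      ≤⟨ +-monoʳ-≤ (d * (A - B)) (*-monoʳ-≤-nonNeg (x≤0⇒0≤-x d≤0) -ε≤A+B) ⟩
      d * (A - B) + - d * (A + B)  ≡⟨ solve 3 (λ d A B → d :* (A :- B) :+ :- d :* (A :+ B)
                                                     := con (ℤ.+ 2) :* (:- d :* B)) refl d A B ⟩
      fromℕ 2 * (- d * B)          ≤⟨ *-monoʳ-≤-nonNeg (0≤fromℕ 2) (inverse-bound 0<b -d≤b) ⟩
      fromℕ 2 * 1#                 ≡⟨ *-identityʳ _ ⟩
      fromℕ 2                      ∎
      where
      -d≤b : - d ≤ b
      -d≤b = ≤-respʳ-≈ (-‿involutive b) (neg-antimono-≤ -b≤d)

  sumFin≡sum : ∀ k (g : Fin k → Carrier) → sumFin k g ≡ sum g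
  sumFin≡sum zero    g = refl
  sumFin≡sum (suc k) g = cong (g zero +_) (sumFin≡sum k (λ i → g (suc i)))

  ∑-neg : ∀ {k} (g : Fin k → Carrier) → sum (λ i → - g i) ≡ - sum g
  ∑-neg {zero}  g = sym -0#≈0#
  ∑-neg {suc k} g = trans (cong (- g zero +_) (∑-neg (λ i → g (suc i)))) (⁻¹-∙-comm _ _)

  ∑-distrib-- : ∀ {k} (f g : Fin k → Carrier) → sum (λ i → f i - g i) ≡ sum f - sum g
  ∑-distrib-- f g = trans (∑-distrib-+ f (λ i → - g i)) (cong (sum f +_) (∑-neg g))

  ∑-mono-≤ : ∀ {k} {f g : Fin k → Carrier} → (∀ i → f i ≤ g i) → sum f ≤ sum g
  ∑-mono-≤ {zero}  f≤g = ≤-refl 0#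
  ∑-mono-≤ {suc k} f≤g = +-mono-≤ (f≤g zero) (∑-mono-≤ (λ i → f≤g (suc i)))

  ∑-nonNeg : ∀ {k} {f : Fin k → Carrier} → (∀ i → 0# ≤ f i) → 0# ≤ sum f
  ∑-nonNeg {zero}  0≤f = ≤-refl 0#
  ∑-nonNeg {suc k} 0≤f = ≤-respˡ-≈ (+-identityʳ 0#) (+-mono-≤ (0≤f zero) (∑-nonNeg (λ i → 0≤f (suc i))))

  term≤∑-nonNeg : ∀ {k} {f : Fin k → Carrier} → (∀ i → 0# ≤ f i) → ∀ j → f j ≤ sum f
  term≤∑-nonNeg {suc k} {f} 0≤f zero    = x≤x+y (f zero) (∑-nonNeg (λ i → 0≤f (suc i)))
  term≤∑-nonNeg {suc k} {f} 0≤f (suc j) =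
    ≤-respˡ-≈ (+-identityˡ _) (+-mono-≤ (0≤f zero) (term≤∑-nonNeg (λ i → 0≤f (suc i)) j))

  ∑-const : ∀ k c → sum {k} (λ _ → c) ≡ c * fromℕ k
  ∑-const zero    c = sym (zeroʳ c)
  ∑-const (suc k) c = begin
    c + sum {k} (λ _ → c)   ≡⟨ cong₂ _+_ (sym (*-identityʳ c)) (∑-const k c) ⟩
    c * 1# + c * fromℕ k    ≡⟨ sym (distribˡ c 1# (fromℕ k)) ⟩
    c * fromℕ (suc k)       ∎
    where open ≡-Reasoning

  [suc≟suc]𝟙 : ∀ {k} (a b : Fin k) → [ suc a ≟ suc b ]𝟙 ≡ [ a ≟ b ]𝟙
  [suc≟suc]𝟙 a b with a Fin.≟ b
  ... | yes _ = refl
  ... | no  _ = refl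

  ∑-indicator : ∀ {k} (a : Fin k) (g : Fin k → Carrier) → sum (λ v → [ a ≟ v ]𝟙 * g v) ≡ g a
  ∑-indicator {suc k} zero    g = begin
    1# * g zero + sum (λ i → 0# * g (suc i))   ≡⟨ cong₂ _+_ (*-identityˡ _) (sum-cong-≗ (λ i → zeroˡ (g (suc i)))) ⟩
    g zero + sum {k} (λ _ → 0#)                ≡⟨ cong (g zero +_) (trans (∑-const k 0#) (zeroˡ _)) ⟩
    g zero + 0#                                ≡⟨ +-identityʳ _ ⟩
    g zero                                     ∎
    where open ≡-Reasoning
  ∑-indicator {suc k} (suc a) g = begin
    0# * g zero + sum (λ i → [ suc a ≟ suc i ]𝟙 * g (suc i))
      ≡⟨ cong₂ _+_ (zeroˡ _) (sum-cong-≗ (λ i → cong (_* g (suc i)) ([suc≟suc]𝟙 a i))) ⟩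
    0# + sum (λ i → [ a ≟ i ]𝟙 * g (suc i))
      ≡⟨ trans (+-identityˡ _) (∑-indicator a (λ i → g (suc i))) ⟩
    g (suc a) ∎
    where open ≡-Reasoning

module FlowProperties (R : RealField) {n m : ℕ} (G : Network n m) where
  open RealField R hiding (+-mono-≤)
  open RealFieldProperties R
  open Flows R G
  open Network G

  ∑-incidence : (p : Fin m → Fin n) (h : Vec𝔼) (y : Vec𝕍) →
                sum (λ v → sum (λ e → [ p e ≟ v ]𝟙 * h e) * y v) ≡ sum (λ e → h e * y (p e))
  ∑-incidence p h y = begin
    sum (λ v → sum (λ e → [ p e ≟ v ]𝟙 * h e) * y v)   ≡⟨ sum-cong-≗ (λ v → *-distribʳ-sum (y v) (λ e → [ p e ≟ v ]𝟙 * h e)) ⟩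
    sum (λ v → sum (λ e → [ p e ≟ v ]𝟙 * h e * y v))   ≡⟨ ∑-comm (λ v e → [ p e ≟ v ]𝟙 * h e * y v) ⟩
    sum (λ e → sum (λ v → [ p e ≟ v ]𝟙 * h e * y v))   ≡⟨ sum-cong-≗ (λ e → sum-cong-≗ (λ v → *-assoc [ p e ≟ v ]𝟙 (h e) (y v))) ⟩
    sum (λ e → sum (λ v → [ p e ≟ v ]𝟙 * (h e * y v))) ≡⟨ sum-cong-≗ (λ e → ∑-indicator (p e) (λ v → h e * y v)) ⟩
    sum (λ e → h e * y (p e))                          ∎
    where open ≡-Reasoning

  dot𝕍-flow : ∀ {σ h} (y : Vec𝕍) → IsFlow σ h → dot𝕍 σ y ≡ sum (λ e → h e * Δ y e)
  dot𝕍-flow {σ} {h} y h-flow = begin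
    dot𝕍 σ y                                              ≡⟨ sumFin≡sum n (λ v → σ v * y v) ⟩
    sum (λ v → σ v * y v)                                 ≡⟨ sum-cong-≗ (λ v → cong (_* y v) (sym (conservation v))) ⟩
    sum (λ v → (inflow v - outflow v) * y v)              ≡⟨ sum-cong-≗ (λ v → solve 3 (λ i o y → (i :- o) :* y := i :* y :- o :* y)
                                                                                  refl (inflow v) (outflow v) (y v)) ⟩
    sum (λ v → inflow v * y v - outflow v * y v)          ≡⟨ ∑-distrib-- (λ v → inflow v * y v) (λ v → outflow v * y v) ⟩
    sum (λ v → inflow v * y v) - sum (λ v → outflow v * y v)
                                                          ≡⟨ cong₂ _-_ (∑-incidence head h y) (∑-incidence tail h y) ⟩
    sum (λ e → h e * y (head e)) - sum (λ e → h e * y (tail e))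
                                                          ≡⟨ sym (∑-distrib-- (λ e → h e * y (head e)) (λ e → h e * y (tail e))) ⟩
    sum (λ e → h e * y (head e) - h e * y (tail e))       ≡⟨ sum-cong-≗ (λ e → solve 3 (λ h y₁ y₀ → h :* y₁ :- h :* y₀ := h :* (y₁ :- y₀))
                                                                                  refl (h e) (y (head e)) (y (tail e))) ⟩
    sum (λ e → h e * Δ y e)                               ∎
    where
    open ≡-Reasoning
    inflow outflow : Vec𝕍
    inflow  v = sum (λ e → [ head e ≟ v ]𝟙 * h e)
    outflow v = sum (λ e → [ tail e ≟ v ]𝟙 * h e)
    conservation : ∀ v → inflow v - outflow v ≡ σ v
    conservation v = trans (sym (cong₂ _-_ (sumFin≡sum m (λ e → [ head e ≟ v ]𝟙 * h e)) (sumFin≡sum m (λ e → [ tail e ≟ v ]𝟙 * h e)))) (h-flow v)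

  dot𝕍-χ : ∀ s t F α y → dot𝕍 (χ[ s ] t F α) y ≡ α * dot𝕍 (χ[ s ] t F 1#) y
  dot𝕍-χ s t F α y = begin
    dot𝕍 (χ[ s ] t F α) y                              ≡⟨ sumFin≡sum n (λ v → α * F * χst s t v * y v) ⟩
    sum (λ v → α * F * χst s t v * y v)                ≡⟨ sum-cong-≗ pull-α ⟩
    sum (λ v → α * (1# * F * χst s t v * y v))         ≡⟨ sym (*-distribˡ-sum α (λ v → 1# * F * χst s t v * y v)) ⟩
    α * sum (λ v → 1# * F * χst s t v * y v)           ≡⟨ cong (α *_) (sym (sumFin≡sum n (λ v → 1# * F * χst s t v * y v))) ⟩
    α * dot𝕍 (χ[ s ] t F 1#) y                         ∎
    where
    open ≡-Reasoning
    pull-α : ∀ v → α * F * χst s t v * y v ≡ α * (1# * F * χst s t v * y v)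
    pull-α v = trans (solve 4 (λ α F c y → α :* F :* c :* y := α :* (F :* c :* y)) refl α F (χst s t v) (y v))
                     (cong (λ w → α * (w * χst s t v * y v)) (sym (*-identityˡ F)))

  ‖γ‖₂≤c⇒γ≤1 : ∀ {γ c} → 0# ≤ c → c ≤ 1# → ‖ γ ‖₂≤ c → ∀ e → γ e ≤ 1#
  ‖γ‖₂≤c⇒γ≤1 {γ} {c} 0≤c c≤1 ‖γ‖≤c e = x*x≤1⇒x≤1 (begin
    γ e * γ e                   ≤⟨ term≤∑-nonNeg (λ i → 0≤x*x (γ i)) e ⟩
    sum (λ i → γ i * γ i)       ≡⟨ sym (sumFin≡sum m (λ i → γ i * γ i)) ⟩
    sumFin m (λ i → γ i * γ i)  ≤⟨ ‖γ‖≤c ⟩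
    c * c                       ≤⟨ 0≤x≤1⇒x*x≤1 0≤c c≤1 ⟩
    1#                          ∎)
    where open ≤-Reasoning

  coupled-arc≤2 : ∀ {γ f g y} → Coupled γ f y → (∀ e → γ e ≤ 1#) → Feasible g →
                  ∀ e → (g e - f e) * Δ y e ≤ fromℕ 2
  coupled-arc≤2 {f = f} {g} coupled γ≤1 g-feasible e with coupled e | g-feasible e
  ... | 0<û⁺ , 0<û⁻ , close | -u⁻≤g , g≤u⁺ =
    coupled-step≤2 0<û⁺ 0<û⁻ -û⁻≤g-f (+-monoˡ-≤ (- f e) g≤u⁺) (γ≤1 e) close
    where
    -û⁻≤g-f : - û⁻ f e ≤ g e - f e
    -û⁻≤g-f = ≤-respˡ-≈ (solve 2 (λ u f → :- u :+ :- f := :- (u :+ f)) refl (fromℕ (u⁻ e)) (f e))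
                        (+-monoˡ-≤ (- f e) -u⁻≤g)

  χ-routing-bound : ∀ {s t F α γ f g y} → IsFlow (χ[ s ] t F α) f → Coupled γ f y → (∀ e → γ e ≤ 1#) →
                    IsFlow (χ[ s ] t F 1#) g → Feasible g →
                    (1# - α) * dot𝕍 (χ[ s ] t F 1#) y ≤ fromℕ 2 * fromℕ m
  χ-routing-bound {s} {t} {F} {α} {γ} {f} {g} {y} f-flow coupled γ≤1 g-flow g-feasible = begin
    (1# - α) * X                                   ≡⟨ solve 3 (λ o α X → (o :- α) :* X := o :* X :- α :* X) refl 1# α X ⟩
    1# * X - α * X                                 ≡⟨ cong₂ _-_ (*-identityˡ X) (sym (dot𝕍-χ s t F α y)) ⟩
    X - dot𝕍 (χ[ s ] t F α) y                      ≡⟨ cong₂ _-_ (dot𝕍-flow y g-flow) (dot𝕍-flow y f-flow) ⟩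
    sum (λ e → g e * Δ y e) - sum (λ e → f e * Δ y e)
                                                   ≡⟨ sym (∑-distrib-- (λ e → g e * Δ y e) (λ e → f e * Δ y e)) ⟩
    sum (λ e → g e * Δ y e - f e * Δ y e)          ≡⟨ sum-cong-≗ (λ e → solve 3 (λ g f δ → g :* δ :- f :* δ := (g :- f) :* δ)
                                                                            refl (g e) (f e) (Δ y e)) ⟩
    sum (λ e → (g e - f e) * Δ y e)                ≤⟨ ∑-mono-≤ (coupled-arc≤2 {γ} {f} {g} {y} coupled γ≤1 g-feasible) ⟩
    sum {m} (λ _ → fromℕ 2)                        ≡⟨ ∑-const m (fromℕ 2) ⟩
    fromℕ 2 * fromℕ m                              ∎
    where
    open ≤-Reasoning
    X : Carrier
    X = dot𝕍 (χ[ s ] t F 1#) y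

mainTheorem4 : (R : RealField) → (n m : ℕ) → (G : Network n m) →
    (s t : Fin n) → (F α : RealField.Carrier R) →
    let open RealField R
        open Flows R G
    in 0# < F → 0# ≤ α → α < 1# →
       (f : Vec𝔼) → (y : Vec𝕍) →
       IsFlow (χ[ s ] t F α) f → Feasible f → WellCoupled f y →
       fromℕ 2 * fromℕ m / (1# - α) < dot𝕍 (χ[ s ] t F 1#) y →
       ¬ (Σ Vec𝔼 (λ g → IsFlow (χ[ s ] t F 1#) g × Feasible g))
mainTheorem4 R n m G s t F α _ _ α<1 f y f-flow _ (γ , coupled , ‖γ‖≤1/100) bound<χᵀy (g , g-flow , g-feasible) =
  proj₂ bound<χᵀy (≤-antisym (proj₁ bound<χᵀy) χᵀy≤bound)
  where
  open RealField R hiding (+-mono-≤)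
  open RealFieldProperties R
  open Flows R G
  open FlowProperties R G

  γ≤1 : ∀ e → γ e ≤ 1#
  γ≤1 = let 0≤1/100 , 1/100≤1 = 1≤x⇒0≤1/x≤1 (1≤fromℕ[1+n] 99) in ‖γ‖₂≤c⇒γ≤1 0≤1/100 1/100≤1 ‖γ‖≤1/100

  χᵀy≤bound : dot𝕍 (χ[ s ] t F 1#) y ≤ fromℕ 2 * fromℕ m / (1# - α)
  χᵀy≤bound = z*x≤y⇒x≤y/z (x<y⇒0<y-x α<1) (χ-routing-bound f-flow coupled γ≤1 g-flow g-feasible)
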